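{- Let $G=(V,E)$ be a finite simple graph with $|V|=n$. Then $G$ is special $2$-threshold if and only if there exist an ordering $v_1,\dots,v_n$ of $V$ and a subset $U\subseteq V$ such that for every $i\in\{1,\dots,n\}$, $$N^<(v_i)=\emptyset\quad\text{or}\quad N^<(v_i)=U\cap\{v_1,\dots,v_{i-1}\}.$$
   Context: Graphs are finite, without loops or parallel edges. For $v\in V$, $N(v)$ is the set of vertices adjacent to $v$; for $W\subseteq V$, $N_W(v)=N(v)\cap W$, and $G[W]$ is the induced subgraph on $W$. Given an ordering $v_1,\dots,v_n$ of $V$, the lower neighborhood of $v_i$ is $N^<(v_i)=N(v_i)\cap\{v_1,\dots,v_{i-1}\}$. For $U\subseteq V$, $G$ is called $U$-threshold if for every nonempty $W\subseteq V$ the induced subgraph $G[W]$ contains a vertex $v$ with $N_W(v)=\emptyset$ or $N_W(v)=(W\setminus\{v\})\cap U$. $G$ is special $2$-threshold if it is $U$-threshold for some $U\subseteq V$. -}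

module Defs where

open import Data.Nat using (ℕ)
open import Data.Bool using (Bool; true; false)
open import Data.Fin using (Fin; _<_)
open import Data.Fin.Subset using (Subset; _∈_; Nonempty)
open import Data.Fin.Permutation using (Permutation′; _⟨$⟩ʳ_)
open import Data.Product using (Σ; _×_; ∃)
open import Data.Sum using (_⊎_)
open import Relation.Nullary using (¬_)
open import Relation.Binary.PropositionalEquality using (_≡_; _≢_)
open import Function.Bundles using (_⇔_)

record Graph (n : ℕ) : Set where
  field
    adj    : Fin n → Fin n → Bool
    sym    : ∀ u v → adj u v ≡ adj v u
    irrefl : ∀ v → adj v v ≡ false

module _ {n : ℕ} (G : Graph n) where
  open Graph G

  Adj : Fin n → Fin n → Set
  Adj u v = adj u v ≡ true

  NoNbrIn : Subset n → Fin n → Set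
  NoNbrIn W v = ∀ w → w ∈ W → ¬ Adj v w

  NbrIn≡ : Subset n → Subset n → Fin n → Set
  NbrIn≡ U W v = ∀ w → w ∈ W → w ≢ v → (Adj v w ⇔ w ∈ U)

  IsThreshold : Subset n → Set
  IsThreshold U = ∀ (W : Subset n) → Nonempty W →
    Σ (Fin n) λ v → v ∈ W × (NoNbrIn W v ⊎ NbrIn≡ U W v)

  Special2Threshold : Set
  Special2Threshold = ∃ λ (U : Subset n) → IsThreshold U

  OrderCond : Permutation′ n → Subset n → Fin n → Set
  OrderCond σ U i =
    (∀ j → j < i → ¬ Adj (σ ⟨$⟩ʳ i) (σ ⟨$⟩ʳ j))
    ⊎ (∀ j → j < i → (Adj (σ ⟨$⟩ʳ i) (σ ⟨$⟩ʳ j) ⇔ (σ ⟨$⟩ʳ j) ∈ U))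

-- The vertex of W that comes last in an ordering as in the theorem has all its W-neighbours
-- before it, so its ordering condition is precisely the U-threshold condition in G[W].
-- Conversely, the U-threshold property of the set of vertices not yet placed supplies a
-- vertex that may be placed last, and the remaining vertices are ordered recursively; to make
-- this recursion structural, we order injective sequences f : Fin m → Fin n rather than V.
module Submission where

open import Defs
open import Data.Nat using (ℕ; zero; suc; z≤n; s≤s) renaming (_<_ to _<ℕ_)
import Data.Nat.Properties as ℕ
open import Data.Fin using (Fin; zero; suc; fromℕ; inject₁; punchIn; toℕ; _≟_; _<_; _≤_)
open import Data.Fin.Properties
  using (toℕ-fromℕ; toℕ-inject₁; inject₁ℕ<; <-irrefl; ≤∧≢⇒<; any?; punchIn-injective; punchInᵢ≢i)
open import Data.Fin.Relation.Unary.Top using (view; ‵fromℕ; ‵inject₁)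
open import Data.Fin.Subset using (Subset; _∈_; Nonempty)
open import Data.Fin.Subset.Properties using (_∈?_)
open import Data.Fin.Permutation
  using (Permutation; Permutation′; _⟨$⟩ʳ_; _⟨$⟩ˡ_; inverseʳ; insert; insert-punchIn; id)
open import Data.Vec using (tabulate)
open import Data.Vec.Properties using (lookup∘tabulate; lookup⇒[]=; []=⇒lookup)
open import Data.Product using (Σ; _×_; ∃; _,_)
import Data.Sum as Sum
open import Data.Sum using (_⊎_)
open import Relation.Nullary using (¬_; yes; no; does; contradiction)
open import Relation.Nullary.Decidable using (dec-true)
open import Relation.Unary using (Decidable)
open import Relation.Binary.PropositionalEquality
  using (_≡_; _≢_; _≗_; refl; sym; trans; cong; subst; subst₂)
open import Function.Base using (_∘_)
open import Function.Bundles using (_⇔_; mk⇔)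
open import Function.Definitions using (Injective)

private
  variable
    m n : ℕ

fromℕ≮inject₁ : (i : Fin m) → ¬ fromℕ m < inject₁ i
fromℕ≮inject₁ {m} i lt = ℕ.<-asym (inject₁ℕ< i) (subst (λ a → a <ℕ toℕ (inject₁ i)) (toℕ-fromℕ m) lt)

inject₁-cancel-< : {i j : Fin m} → inject₁ j < inject₁ i → j < i
inject₁-cancel-< {i = i} {j} = subst₂ _<ℕ_ (toℕ-inject₁ j) (toℕ-inject₁ i)

below-fromℕ : {P : Fin (suc m) → Set} → (∀ j → P (inject₁ j)) → ∀ j → j < fromℕ m → P j
below-fromℕ P∘inject₁ j j< with view j
... | ‵fromℕ      = contradiction j< (<-irrefl refl)
... | ‵inject₁ j′ = P∘inject₁ j′

below-inject₁ : {P : Fin (suc m) → Set} {i : Fin m} →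
                (∀ j → j < i → P (inject₁ j)) → ∀ j → j < inject₁ i → P j
below-inject₁ {i = i} P∘inject₁ j j< with view j
... | ‵fromℕ      = contradiction j< (fromℕ≮inject₁ i)
... | ‵inject₁ j′ = P∘inject₁ j′ (inject₁-cancel-< j<)

punchIn-fromℕ : (j : Fin m) → punchIn (fromℕ m) j ≡ inject₁ j
punchIn-fromℕ zero    = refl
punchIn-fromℕ (suc j) = cong suc (punchIn-fromℕ j)

insert-here : ∀ i j (π : Permutation m n) → insert i j π ⟨$⟩ʳ i ≡ j
insert-here i j π with i ≟ i
... | yes _   = refl
... | no i≢i = contradiction refl i≢i

insert-inject₁ : ∀ k (π : Permutation m n) j →
                 insert (fromℕ m) k π ⟨$⟩ʳ inject₁ j ≡ punchIn k (π ⟨$⟩ʳ j)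
insert-inject₁ {m} k π j =
  trans (cong (insert (fromℕ m) k π ⟨$⟩ʳ_) (sym (punchIn-fromℕ j))) (insert-punchIn (fromℕ m) k π j)

greatest : {P : Fin m → Set} → Decidable P → ∃ P → ∃ λ i → P i × (∀ j → P j → j ≤ i)
greatest {suc m} P? (k , Pk) with any? (P? ∘ suc)
... | yes ∃P∘suc with greatest (P? ∘ suc) ∃P∘suc
...   | i , Pi , max = suc i , Pi , λ { zero _ → z≤n ; (suc j) Pj → s≤s (max j Pj) }
greatest P? (zero , P0)  | no ∄P∘suc = zero , P0 , λ { zero _ → z≤n ; (suc j) Pj → contradiction (j , Pj) ∄P∘suc }
greatest P? (suc k , Pk) | no ∄P∘suc = contradiction (k , Pk) ∄P∘suc

latest : (σ : Permutation′ n) (W : Subset n) → Nonempty W →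
         ∃ λ i → σ ⟨$⟩ʳ i ∈ W × (∀ {w} → w ∈ W → w ≢ σ ⟨$⟩ʳ i → σ ⟨$⟩ˡ w < i)
latest σ W (x , x∈W) =
  let i , σi∈W , max = greatest (λ j → σ ⟨$⟩ʳ j ∈? W) (σ ⟨$⟩ˡ x , σσ⁻¹∈ x∈W)
  in i , σi∈W , λ w∈W w≢σi →
       ≤∧≢⇒< (max _ (σσ⁻¹∈ w∈W)) (λ σ⁻¹w≡i → w≢σi (trans (sym (inverseʳ σ)) (cong (σ ⟨$⟩ʳ_) σ⁻¹w≡i)))
  where
  σσ⁻¹∈ : ∀ {w} → w ∈ W → σ ⟨$⟩ʳ (σ ⟨$⟩ˡ w) ∈ W
  σσ⁻¹∈ = subst (_∈ W) (sym (inverseʳ σ))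

image : (Fin m → Fin n) → Subset n
image f = tabulate λ w → does (any? λ k → f k ≟ w)

∈-image⁺ : (f : Fin m → Fin n) (k : Fin m) → f k ∈ image f
∈-image⁺ f k = lookup⇒[]= (f k) (image f) (trans (lookup∘tabulate _ (f k)) (dec-true (any? _) (k , refl)))

∈-image⁻ : (f : Fin m → Fin n) (w : Fin n) → w ∈ image f → ∃ λ k → f k ≡ w
∈-image⁻ f w w∈ with any? (λ k → f k ≟ w) | trans (sym (lookup∘tabulate _ w)) ([]=⇒lookup w∈)
... | yes fk≡w | _  = fk≡w
... | no _     | ()

module _ {n : ℕ} (G : Graph n) (U : Subset n) where

  open Graph G using (irrefl)

  ThresholdVertex : Subset n → Fin n → Set
  ThresholdVertex W v = NoNbrIn G W v ⊎ NbrIn≡ G U W v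

  Admissible : (Fin m → Fin n) → Fin m → Set
  Admissible g i = (∀ j → j < i → ¬ Adj G (g i) (g j))
                 ⊎ (∀ j → j < i → (Adj G (g i) (g j) ⇔ g j ∈ U))

  ThresholdOrder : (Fin m → Fin n) → Set
  ThresholdOrder g = ∀ i → Admissible g i

  thresholdOrder-resp-≗ : {g h : Fin m → Fin n} → g ≗ h → ThresholdOrder g → ThresholdOrder h
  thresholdOrder-resp-≗ g≗h ord i = Sum.map
    (λ c j j<i → subst₂ (λ x y → ¬ Adj G x y) (g≗h i) (g≗h j) (c j j<i))
    (λ c j j<i → subst₂ (λ x y → Adj G x y ⇔ y ∈ U) (g≗h i) (g≗h j) (c j j<i))
    (ord i)

  thresholdOrder-snoc : (g : Fin (suc m) → Fin n) (W : Subset n) →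
                        ThresholdOrder (g ∘ inject₁) →
                        (∀ j → g (inject₁ j) ∈ W) → (∀ j → g (inject₁ j) ≢ g (fromℕ m)) →
                        ThresholdVertex W (g (fromℕ m)) → ThresholdOrder g
  thresholdOrder-snoc g W ord _ _ _ i with view i
  thresholdOrder-snoc g W ord _ _ _ _ | ‵inject₁ i =
    Sum.map below-inject₁ below-inject₁ (ord i)
  thresholdOrder-snoc g W _ ∈W distinct last-ok _ | ‵fromℕ = Sum.map
    (λ none → below-fromℕ λ j → none (g (inject₁ j)) (∈W j))
    (λ dom  → below-fromℕ λ j → dom (g (inject₁ j)) (∈W j) (distinct j))
    last-ok

  thresholdOrdering : IsThreshold G U → (f : Fin m → Fin n) → Injective _≡_ _≡_ f →
                      Σ (Permutation′ m) λ π → ThresholdOrder (f ∘ (π ⟨$⟩ʳ_))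
  thresholdOrdering {zero}  thr f f-inj = id , λ ()
  thresholdOrdering {suc m} thr f f-inj with thr (image f) (f zero , ∈-image⁺ f zero)
  ... | v , v∈ , v-ok with ∈-image⁻ f v v∈
  ... | k , refl with thresholdOrdering thr (f ∘ punchIn k) (punchIn-injective k _ _ ∘ f-inj)
  ... | π′ , ord′ = π , thresholdOrder-snoc (f ∘ (π ⟨$⟩ʳ_)) (image f)
      (thresholdOrder-resp-≗ (λ j → cong f (sym (init≡ j))) ord′)
      (λ j → ∈-image⁺ f _)
      (λ j fπj≡fπm → punchInᵢ≢i k (π′ ⟨$⟩ʳ j) (trans (sym (init≡ j)) (trans (f-inj fπj≡fπm) last≡)))
      (subst (ThresholdVertex (image f)) (sym (cong f last≡)) v-ok)
    where
    π = insert (fromℕ m) k π′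
    last≡ : π ⟨$⟩ʳ fromℕ m ≡ k
    last≡ = insert-here (fromℕ m) k π′
    init≡ : ∀ j → π ⟨$⟩ʳ inject₁ j ≡ punchIn k (π′ ⟨$⟩ʳ j)
    init≡ = insert-inject₁ k π′

  thresholdOrder⇒isThreshold : (σ : Permutation′ n) → ThresholdOrder (σ ⟨$⟩ʳ_) → IsThreshold G U
  thresholdOrder⇒isThreshold σ ord W W≢∅ with latest σ W W≢∅
  ... | i , v∈W , earlier = v , v∈W , Sum.map none dom (ord i)
    where
    v = σ ⟨$⟩ʳ i
    none : (∀ j → j < i → ¬ Adj G v (σ ⟨$⟩ʳ j)) → NoNbrIn G W v
    none c w w∈W adj with w ≟ v
    ... | yes refl = contradiction (trans (sym adj) (irrefl v)) λ ()
    ... | no w≢v   = c _ (earlier w∈W w≢v) (subst (Adj G v) (sym (inverseʳ σ)) adj)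
    dom : (∀ j → j < i → (Adj G v (σ ⟨$⟩ʳ j) ⇔ σ ⟨$⟩ʳ j ∈ U)) → NbrIn≡ G U W v
    dom c w w∈W w≢v = subst (λ y → Adj G v y ⇔ y ∈ U) (inverseʳ σ) (c _ (earlier w∈W w≢v))

theorem3p2 : (n : ℕ) (G : Graph n) →
    Special2Threshold G ⇔
      Σ (Permutation′ n) (λ σ → Σ (Subset n) (λ U → (i : Fin n) → OrderCond G σ U i))
theorem3p2 n G = mk⇔
  (λ (U , thr) → let σ , ord = thresholdOrdering G U thr (λ v → v) (λ eq → eq) in σ , U , ord)
  (λ (σ , U , ord) → U , thresholdOrder⇒isThreshold G U σ ord)
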